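{- Let $\delta\ge 2$, $t\ge\delta+1$ and $n$ be integers. If every simple graph $G$ on $n$ vertices with minimum degree exactly $\delta$ satisfies $i_t(G)\le i_t(K_{\delta,n-\delta})$, then every such graph also satisfies $i_{t+1}(G)\le i_{t+1}(K_{\delta,n-\delta})$.
   Context: $i_t(G)$ denotes the number of independent sets of size $t$ in $G$ (sets of $t$ vertices spanning no edges). $K_{a,b}$ is the complete bipartite graph with partite sets of sizes $a$ and $b$. -}

module Defs where

open import Data.Nat using (ℕ; zero; suc; _<ᵇ_; _≤_; _≡ᵇ_)
open import Data.Bool using (Bool; true; false; _∧_; _∨_; _xor_; not)
open import Data.Fin using (Fin; toℕ)
open import Data.Fin.Subset using (Subset; ∣_∣)
open import Data.Vec using (Vec; []; _∷_; lookup; allFin; toList)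
open import Data.List using (List; []; _∷_; map; _++_; length; foldr; filterᵇ)
open import Data.Product using (Σ; _×_; ∃)
open import Relation.Binary.PropositionalEquality using (_≡_)

record Graph (n : ℕ) : Set where
  field
    adj     : Fin n → Fin n → Bool
    adj-sym : ∀ u v → adj u v ≡ adj v u
    loopless : ∀ v → adj v v ≡ false
open Graph public

vertices : (n : ℕ) → List (Fin n)
vertices n = toList (allFin n)

degree : ∀ {n} → Graph n → Fin n → ℕ
degree G v = length (filterᵇ (adj G v) (vertices _))

MinDegreeExactly : ∀ {n} → Graph n → ℕ → Set
MinDegreeExactly {n} G δ = (∀ v → δ ≤ degree G v) × ∃ λ v → degree G v ≡ δ

allSubsets : (n : ℕ) → List (Subset n)
allSubsets zero = [] ∷ []
allSubsets (suc n) = map (false ∷_) (allSubsets n) ++ map (true ∷_) (allSubsets n)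

allᵇ : ∀ {A : Set} → (A → Bool) → List A → Bool
allᵇ p = foldr (λ x b → p x ∧ b) true

isIndependentᵇ : ∀ {n} → Graph n → Subset n → Bool
isIndependentᵇ {n} G S =
  allᵇ (λ u → allᵇ (λ v → not (lookup S u ∧ lookup S v ∧ adj G u v)) (vertices n)) (vertices n)

iₜ : ∀ {n} → ℕ → Graph n → ℕ
iₜ {n} t G = length (filterᵇ (λ S → (∣ S ∣ ≡ᵇ t) ∧ isIndependentᵇ G S) (allSubsets n))

-- K_{δ,n-δ} on Fin n: part A = {v | toℕ v < δ}, B = rest; u ~ v iff in different parts.
private
  inA : ∀ {n} → ℕ → Fin n → Bool
  inA δ v = toℕ v <ᵇ δ

  xor-sym : ∀ a b → a xor b ≡ b xor a
  xor-sym false false = Relation.Binary.PropositionalEquality.refl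
  xor-sym false true = Relation.Binary.PropositionalEquality.refl
  xor-sym true false = Relation.Binary.PropositionalEquality.refl
  xor-sym true true = Relation.Binary.PropositionalEquality.refl

  xor-self : ∀ a → a xor a ≡ false
  xor-self false = Relation.Binary.PropositionalEquality.refl
  xor-self true = Relation.Binary.PropositionalEquality.refl

completeBipartite : (δ n : ℕ) → Graph n
completeBipartite δ n = record
  { adj = λ u v → inA δ u xor inA δ v
  ; adj-sym = λ u v → xor-sym (inA δ u) (inA δ v)
  ; loopless = λ v → xor-self (inA δ v)
  }

-- The proof double counts pairs (S, v) with S an independent t-set, v ∉ S and
-- S ∪ {v} independent.  Writing ext_G(S) for the number of such v,
--     (t+1) · i_{t+1}(G) = Σ_S ext_G(S),
-- because an independent (t+1)-set T arises from exactly |T| pairs.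
--  * In G: fix u ∈ S.  Every extension vertex lies outside S ∪ N(u), and S,
--    N(u) are disjoint, so ext_G(S) ≤ n - t - deg u ≤ n - t - δ.
--  * In K: since t > δ, an independent t-set S avoids the small side A, and
--    every vertex outside S ∪ A extends it, so ext_K(S) ≥ n - t - |A| ≥ n - t - δ.
--  Both counts are instances of one fact: for disjoint vertex sets A, B,
--  |V \ (A ∪ B)| = n - |A| - |B|.
module Submission where

open import Defs
open import Data.Nat using (ℕ; zero; suc; _+_; _*_; _∸_; _≤_; _<_; _<ᵇ_; _≡ᵇ_; z≤n; s≤s; >-nonZero)
open import Data.Nat.Properties
open import Algebra.Properties.Semiring.Sum +-*-semiring
  using (sum; sum-cong-≗; ∑-distrib-+; *-distribˡ-sum; sum-replicate-zero)
open import Algebra.Properties.CommutativeSemigroup +-commutativeSemigroup using (interchange)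
open import Data.Bool using (Bool; true; false; _∧_; _xor_; not; if_then_else_)
open import Data.Bool.Properties using (T-≡)
open import Data.Fin using (Fin; toℕ; zero; suc)
open import Data.Fin.Subset using (Subset; ∣_∣)
open import Data.Vec using ([]; _∷_; lookup; tabulate; toList; _[_]≔_)
open import Data.List using (List; []; _∷_; map; _++_; length; filterᵇ)
open import Data.List.Properties using (filter-++; length-++)
open import Data.Product using (_×_; ∃; _,_; proj₁; proj₂)
open import Data.Sum using (_⊎_; inj₁; inj₂)
open import Data.Empty using (⊥-elim)
open import Function using (_∘_; Equivalence)
open import Relation.Nullary.Decidable using (T?)
open import Relation.Binary.PropositionalEquality

⟦_⟧ : Bool → ℕ
⟦ true ⟧ = 1
⟦ false ⟧ = 0

⟦⟧≤1 : ∀ b → ⟦ b ⟧ ≤ 1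
⟦⟧≤1 true = ≤-refl
⟦⟧≤1 false = z≤n

sum-mono : ∀ {n} {f g : Fin n → ℕ} → (∀ i → f i ≤ g i) → sum f ≤ sum g
sum-mono {zero} _ = z≤n
sum-mono {suc n} f≤g = +-mono-≤ (f≤g zero) (sum-mono (f≤g ∘ suc))

sum-ones : ∀ n → sum (λ (_ : Fin n) → 1) ≡ n
sum-ones zero = refl
sum-ones (suc n) = cong suc (sum-ones n)

∑ₛ : ∀ {n} → (Subset n → ℕ) → ℕ
∑ₛ {zero} f = f []
∑ₛ {suc n} f = ∑ₛ (λ S → f (false ∷ S)) + ∑ₛ (λ S → f (true ∷ S))

∑ₛ-cong : ∀ {n} {f g : Subset n → ℕ} → (∀ S → f S ≡ g S) → ∑ₛ f ≡ ∑ₛ g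
∑ₛ-cong {zero} f≡g = f≡g []
∑ₛ-cong {suc n} f≡g = cong₂ _+_ (∑ₛ-cong (f≡g ∘ (false ∷_))) (∑ₛ-cong (f≡g ∘ (true ∷_)))

∑ₛ-mono : ∀ {n} {f g : Subset n → ℕ} → (∀ S → f S ≤ g S) → ∑ₛ f ≤ ∑ₛ g
∑ₛ-mono {zero} f≤g = f≤g []
∑ₛ-mono {suc n} f≤g = +-mono-≤ (∑ₛ-mono (f≤g ∘ (false ∷_))) (∑ₛ-mono (f≤g ∘ (true ∷_)))

∑ₛ-zero : ∀ n → ∑ₛ (λ (_ : Subset n) → 0) ≡ 0
∑ₛ-zero zero = refl
∑ₛ-zero (suc n) = cong₂ _+_ (∑ₛ-zero n) (∑ₛ-zero n)

∑ₛ-distrib-+ : ∀ {n} (f g : Subset n → ℕ) → ∑ₛ (λ S → f S + g S) ≡ ∑ₛ f + ∑ₛ g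
∑ₛ-distrib-+ {zero} f g = refl
∑ₛ-distrib-+ {suc n} f g =
  trans (cong₂ _+_ (∑ₛ-distrib-+ (f ∘ (false ∷_)) (g ∘ (false ∷_)))
                   (∑ₛ-distrib-+ (f ∘ (true ∷_)) (g ∘ (true ∷_))))
        (interchange (∑ₛ (f ∘ (false ∷_))) (∑ₛ (g ∘ (false ∷_)))
                     (∑ₛ (f ∘ (true ∷_))) (∑ₛ (g ∘ (true ∷_))))

∑ₛ-distribʳ-* : ∀ {n} (f : Subset n → ℕ) c → ∑ₛ (λ S → f S * c) ≡ ∑ₛ f * c
∑ₛ-distribʳ-* {zero} f c = refl
∑ₛ-distribʳ-* {suc n} f c =
  trans (cong₂ _+_ (∑ₛ-distribʳ-* (f ∘ (false ∷_)) c) (∑ₛ-distribʳ-* (f ∘ (true ∷_)) c))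
        (sym (*-distribʳ-+ c (∑ₛ (f ∘ (false ∷_))) (∑ₛ (f ∘ (true ∷_)))))

∑ₛ-sum-comm : ∀ {n m} (g : Subset n → Fin m → ℕ) →
  ∑ₛ (λ S → sum (g S)) ≡ sum (λ v → ∑ₛ (λ S → g S v))
∑ₛ-sum-comm {n} {zero} g = ∑ₛ-zero n
∑ₛ-sum-comm {n} {suc m} g =
  trans (∑ₛ-distrib-+ (λ S → g S zero) (λ S → sum (g S ∘ suc)))
        (cong (∑ₛ (λ S → g S zero) +_) (∑ₛ-sum-comm (λ S → g S ∘ suc)))

count : ∀ {A : Set} → (A → Bool) → List A → ℕ
count p xs = length (filterᵇ p xs)

count-∷ : ∀ {A : Set} (p : A → Bool) x xs → count p (x ∷ xs) ≡ ⟦ p x ⟧ + count p xs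
count-∷ p x xs with p x
... | true = refl
... | false = refl

count-++ : ∀ {A : Set} (p : A → Bool) xs ys → count p (xs ++ ys) ≡ count p xs + count p ys
count-++ p xs ys = trans (cong length (filter-++ (T? ∘ p) xs ys)) (length-++ (filterᵇ p xs))

count-map : ∀ {A B : Set} (p : B → Bool) (g : A → B) xs → count p (map g xs) ≡ count (p ∘ g) xs
count-map p g [] = refl
count-map p g (x ∷ xs) =
  trans (count-∷ p (g x) _) (trans (cong (_ +_) (count-map p g xs)) (sym (count-∷ (p ∘ g) x xs)))

count-tabulate : ∀ {A : Set} {n} (p : A → Bool) (f : Fin n → A) →
  count p (toList (tabulate f)) ≡ sum (λ i → ⟦ p (f i) ⟧)
count-tabulate {n = zero} p f = refl
count-tabulate {n = suc n} p f = trans (count-∷ p (f zero) _) (cong (_ +_) (count-tabulate p (f ∘ suc)))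

count-allSubsets : ∀ n (p : Subset n → Bool) → count p (allSubsets n) ≡ ∑ₛ (λ S → ⟦ p S ⟧)
count-allSubsets zero p = trans (count-∷ p [] []) (+-identityʳ _)
count-allSubsets (suc n) p = trans (count-++ p (map (false ∷_) (allSubsets n)) _)
  (cong₂ _+_ (trans (count-map p (false ∷_) (allSubsets n)) (count-allSubsets n _))
             (trans (count-map p (true ∷_) (allSubsets n)) (count-allSubsets n _)))

degree-as-sum : ∀ {n} (G : Graph n) v → degree G v ≡ sum (λ u → ⟦ adj G v u ⟧)
degree-as-sum G v = count-tabulate (adj G v) (λ u → u)

size-∷ : ∀ {n} b (S : Subset n) → ∣ b ∷ S ∣ ≡ ⟦ b ⟧ + ∣ S ∣
size-∷ true S = refl
size-∷ false S = refl

size-as-sum : ∀ {n} (S : Subset n) → ∣ S ∣ ≡ sum (λ v → ⟦ lookup S v ⟧)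
size-as-sum [] = refl
size-as-sum (b ∷ S) = trans (size-∷ b S) (cong (⟦ b ⟧ +_) (size-as-sum S))

member-of-nonempty : ∀ {n} (S : Subset n) → 1 ≤ ∣ S ∣ → ∃ λ v → lookup S v ≡ true
member-of-nonempty (true ∷ S) _ = zero , refl
member-of-nonempty (false ∷ S) 1≤∣S∣ with member-of-nonempty S 1≤∣S∣
... | v , v∈S = suc v , v∈S

Independent : ∀ {n} → Graph n → Subset n → Set
Independent G S = ∀ u w → lookup S u ≡ true → lookup S w ≡ true → adj G u w ≡ false

allᵇ-tabulate-sound : ∀ {A : Set} {n} (p : A → Bool) (f : Fin n → A) →
  allᵇ p (toList (tabulate f)) ≡ true → ∀ i → p (f i) ≡ true
allᵇ-tabulate-sound {n = suc n} p f all i with p (f zero) in p₀ | i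
... | true | zero = p₀
... | true | suc j = allᵇ-tabulate-sound p (f ∘ suc) all j
allᵇ-tabulate-sound {n = suc n} p f () i | false | _

allᵇ-tabulate-complete : ∀ {A : Set} {n} (p : A → Bool) (f : Fin n → A) →
  (∀ i → p (f i) ≡ true) → allᵇ p (toList (tabulate f)) ≡ true
allᵇ-tabulate-complete {n = zero} p f _ = refl
allᵇ-tabulate-complete {n = suc n} p f all rewrite all zero = allᵇ-tabulate-complete p (f ∘ suc) (all ∘ suc)

independentᵇ-sound : ∀ {n} (G : Graph n) S → isIndependentᵇ G S ≡ true → Independent G S
independentᵇ-sound G S indep u w u∈S w∈S
  with allᵇ-tabulate-sound _ _ (allᵇ-tabulate-sound _ _ indep u) w
... | no-edge rewrite u∈S | w∈S with adj G u w
... | false = refl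

independentᵇ-complete : ∀ {n} (G : Graph n) S → Independent G S → isIndependentᵇ G S ≡ true
independentᵇ-complete G S indep =
  allᵇ-tabulate-complete _ _ (λ u → allᵇ-tabulate-complete _ _ (no-edge u))
  where
  no-edge : ∀ u w → not (lookup S u ∧ lookup S w ∧ adj G u w) ≡ true
  no-edge u w with lookup S u in u∈S | lookup S w in w∈S
  ... | false | _ = refl
  ... | true | false = refl
  ... | true | true rewrite indep u w u∈S w∈S = refl

indepOfSizeᵇ : ∀ {n} → Graph n → ℕ → Subset n → Bool
indepOfSizeᵇ G k S = (∣ S ∣ ≡ᵇ k) ∧ isIndependentᵇ G S

indepOfSizeᵇ-sound : ∀ {n} (G : Graph n) k S →
  indepOfSizeᵇ G k S ≡ true → ∣ S ∣ ≡ k × Independent G S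
indepOfSizeᵇ-sound G k S holds with ∣ S ∣ ≡ᵇ k in size | isIndependentᵇ G S in indep
... | true | true =
  ≡ᵇ⇒≡ _ k (Equivalence.from T-≡ size) , independentᵇ-sound G S indep

indepOfSizeᵇ-complete : ∀ {n} (G : Graph n) k S →
  ∣ S ∣ ≡ k → Independent G S → indepOfSizeᵇ G k S ≡ true
indepOfSizeᵇ-complete G k S size indep
  rewrite Equivalence.to T-≡ (≡⇒≡ᵇ _ k size) | independentᵇ-complete G S indep = refl

iₜ-as-sum : ∀ {n} (G : Graph n) k → iₜ k G ≡ ∑ₛ (λ S → ⟦ indepOfSizeᵇ G k S ⟧)
iₜ-as-sum {n} G k = count-allSubsets n _

insert : ∀ {n} → Subset n → Fin n → Subset n
insert S v = S [ v ]≔ true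

∈-insert : ∀ {n} (S : Subset n) v → lookup (insert S v) v ≡ true
∈-insert (_ ∷ S) zero = refl
∈-insert (_ ∷ S) (suc v) = ∈-insert S v

insert-⊇ : ∀ {n} (S : Subset n) v w → lookup S w ≡ true → lookup (insert S v) w ≡ true
insert-⊇ (_ ∷ S) zero zero _ = refl
insert-⊇ (_ ∷ S) zero (suc w) w∈S = w∈S
insert-⊇ (_ ∷ S) (suc v) zero w∈S = w∈S
insert-⊇ (_ ∷ S) (suc v) (suc w) w∈S = insert-⊇ S v w w∈S

insert-⊆ : ∀ {n} (S : Subset n) v w → lookup (insert S v) w ≡ true → w ≡ v ⊎ lookup S w ≡ true
insert-⊆ (_ ∷ S) zero zero _ = inj₁ refl
insert-⊆ (_ ∷ S) zero (suc w) w∈S = inj₂ w∈S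
insert-⊆ (_ ∷ S) (suc v) zero w∈S = inj₂ w∈S
insert-⊆ (_ ∷ S) (suc v) (suc w) w∈S with insert-⊆ S v w w∈S
... | inj₁ w≡v = inj₁ (cong suc w≡v)
... | inj₂ w∈S′ = inj₂ w∈S′

size-insert : ∀ {n} (S : Subset n) v → lookup S v ≡ false → ∣ insert S v ∣ ≡ suc ∣ S ∣
size-insert (false ∷ S) zero _ = refl
size-insert (b ∷ S) (suc v) v∉S = begin
  ∣ b ∷ insert S v ∣     ≡⟨ size-∷ b (insert S v) ⟩
  ⟦ b ⟧ + ∣ insert S v ∣ ≡⟨ cong (⟦ b ⟧ +_) (size-insert S v v∉S) ⟩
  ⟦ b ⟧ + suc ∣ S ∣      ≡⟨ +-suc ⟦ b ⟧ ∣ S ∣ ⟩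
  suc (⟦ b ⟧ + ∣ S ∣)    ≡⟨ cong suc (size-∷ b S) ⟨
  suc ∣ b ∷ S ∣          ∎
  where open ≡-Reasoning

independent-remove : ∀ {n} (G : Graph n) S v → Independent G (insert S v) → Independent G S
independent-remove G S v indep u w u∈S w∈S = indep u w (insert-⊇ S v u u∈S) (insert-⊇ S v w w∈S)

-- For a fixed v, the sets S ∌ v correspond bijectively to the sets T ∋ v via T = S ∪ {v}.
∑ₛ-insert : ∀ {n} (v : Fin n) (h : Subset n → ℕ) →
  ∑ₛ (λ S → if lookup S v then 0 else h (insert S v)) ≡ ∑ₛ (λ T → if lookup T v then h T else 0)
∑ₛ-insert {suc n} zero h = begin
  with-v + none ≡⟨ cong (with-v +_) (∑ₛ-zero n) ⟩
  with-v + 0    ≡⟨ +-comm with-v 0 ⟩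
  0 + with-v    ≡⟨ cong (_+ with-v) (∑ₛ-zero n) ⟨
  none + with-v ∎
  where
  open ≡-Reasoning
  with-v none : ℕ
  with-v = ∑ₛ (λ S → h (true ∷ S))
  none = ∑ₛ (λ (_ : Subset n) → 0)
∑ₛ-insert (suc v) h = cong₂ _+_ (∑ₛ-insert v (h ∘ (false ∷_))) (∑ₛ-insert v (h ∘ (true ∷_)))

-- Σ_S Σ_{v ∉ S} h(S ∪ {v}) = Σ_T |T| · h(T): each T is reached once per member.
∑-insertions : ∀ {n} (h : Subset n → ℕ) →
  ∑ₛ (λ S → sum (λ v → if lookup S v then 0 else h (insert S v))) ≡ ∑ₛ (λ T → h T * ∣ T ∣)
∑-insertions h = begin
  ∑ₛ (λ S → sum (λ v → if lookup S v then 0 else h (insert S v)))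
    ≡⟨ ∑ₛ-sum-comm (λ S v → if lookup S v then 0 else h (insert S v)) ⟩
  sum (λ v → ∑ₛ (λ S → if lookup S v then 0 else h (insert S v)))
    ≡⟨ sum-cong-≗ (λ v → ∑ₛ-insert v h) ⟩
  sum (λ v → ∑ₛ (λ T → if lookup T v then h T else 0))
    ≡⟨ ∑ₛ-sum-comm (λ T v → if lookup T v then h T else 0) ⟨
  ∑ₛ (λ T → sum (λ v → if lookup T v then h T else 0))
    ≡⟨ ∑ₛ-cong weigh-members ⟩
  ∑ₛ (λ T → h T * ∣ T ∣) ∎
  where
  open ≡-Reasoning
  if-as-product : ∀ b c → (if b then c else 0) ≡ c * ⟦ b ⟧
  if-as-product true c = sym (*-identityʳ c)
  if-as-product false c = sym (*-zeroʳ c)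
  weigh-members : ∀ T → sum (λ v → if lookup T v then h T else 0) ≡ h T * ∣ T ∣
  weigh-members T = begin
    sum (λ v → if lookup T v then h T else 0) ≡⟨ sum-cong-≗ (λ v → if-as-product (lookup T v) (h T)) ⟩
    sum (λ v → h T * ⟦ lookup T v ⟧)          ≡⟨ *-distribˡ-sum (h T) (⟦_⟧ ∘ lookup T) ⟨
    h T * sum (λ v → ⟦ lookup T v ⟧)          ≡⟨ cong (h T *_) (size-as-sum T) ⟨
    h T * ∣ T ∣                               ∎

extensions : ∀ {n} → Graph n → ℕ → Subset n → ℕ
extensions G t S = sum (λ v → if lookup S v then 0 else ⟦ indepOfSizeᵇ G (t + 1) (insert S v) ⟧)

extensions-double-count : ∀ {n} (G : Graph n) t → ∑ₛ (extensions G t) ≡ iₜ (t + 1) G * (t + 1)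
extensions-double-count {n} G t = begin
  ∑ₛ (extensions G t)                         ≡⟨ ∑-insertions (λ T → ⟦ indep T ⟧) ⟩
  ∑ₛ (λ T → ⟦ indep T ⟧ * ∣ T ∣)              ≡⟨ ∑ₛ-cong size-is-t+1 ⟩
  ∑ₛ (λ T → ⟦ indep T ⟧ * (t + 1))            ≡⟨ ∑ₛ-distribʳ-* (⟦_⟧ ∘ indep) (t + 1) ⟩
  ∑ₛ (λ T → ⟦ indep T ⟧) * (t + 1)            ≡⟨ cong (_* (t + 1)) (iₜ-as-sum G (t + 1)) ⟨
  iₜ (t + 1) G * (t + 1)                      ∎
  where
  open ≡-Reasoning
  indep : Subset n → Bool
  indep = indepOfSizeᵇ G (t + 1)
  size-is-t+1 : ∀ T → ⟦ indep T ⟧ * ∣ T ∣ ≡ ⟦ indep T ⟧ * (t + 1)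
  size-is-t+1 T with indep T in holds
  ... | false = refl
  ... | true = cong (1 *_) (proj₁ (indepOfSizeᵇ-sound G (t + 1) T holds))

outside-disjoint-union : ∀ {n} (A B : Fin n → Bool) → (∀ v → A v ≡ true → B v ≡ false) →
  sum (λ v → ⟦ not (A v) ∧ not (B v) ⟧) + (sum (⟦_⟧ ∘ A) + sum (⟦_⟧ ∘ B)) ≡ n
outside-disjoint-union {n} A B disjoint = begin
  sum outside + (sum (⟦_⟧ ∘ A) + sum (⟦_⟧ ∘ B))
    ≡⟨ cong (sum outside +_) (∑-distrib-+ (⟦_⟧ ∘ A) (⟦_⟧ ∘ B)) ⟨
  sum outside + sum (λ v → ⟦ A v ⟧ + ⟦ B v ⟧)
    ≡⟨ ∑-distrib-+ outside (λ v → ⟦ A v ⟧ + ⟦ B v ⟧) ⟨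
  sum (λ v → outside v + (⟦ A v ⟧ + ⟦ B v ⟧))
    ≡⟨ sum-cong-≗ (λ v → exactly-one (A v) (B v) (disjoint v)) ⟩
  sum (λ (_ : Fin n) → 1)
    ≡⟨ sum-ones n ⟩
  n ∎
  where
  open ≡-Reasoning
  outside : Fin n → ℕ
  outside v = ⟦ not (A v) ∧ not (B v) ⟧
  exactly-one : ∀ a b → (a ≡ true → b ≡ false) → ⟦ not a ∧ not b ⟧ + (⟦ a ⟧ + ⟦ b ⟧) ≡ 1
  exactly-one true b a⇒¬b rewrite a⇒¬b refl = refl
  exactly-one false true _ = refl
  exactly-one false false _ = refl

complement-size : ∀ {x a d n} → x + (a + d) ≡ n → x ≡ n ∸ a ∸ d
complement-size {x} {a} {d} {n} eq = begin
  x                   ≡⟨ m+n∸n≡m x (a + d) ⟨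
  x + (a + d) ∸ (a + d) ≡⟨ cong (_∸ (a + d)) eq ⟩
  n ∸ (a + d)         ≡⟨ ∸-+-assoc n a d ⟨
  n ∸ a ∸ d           ∎
  where open ≡-Reasoning

-- Only an independent t-set can be extended: S ∪ {v} with v ∉ S independent of
-- size t + 1 makes S independent of size t.
extensions-of-non-member : ∀ {n} (G : Graph n) t S → indepOfSizeᵇ G t S ≡ false → extensions G t S ≡ 0
extensions-of-non-member {n} G t S not-member = trans (sum-cong-≗ no-extension) (sum-replicate-zero n)
  where
  no-extension : ∀ v → (if lookup S v then 0 else ⟦ indepOfSizeᵇ G (t + 1) (insert S v) ⟧) ≡ 0
  no-extension v with lookup S v in v∈S
  ... | true = refl
  ... | false with indepOfSizeᵇ G (t + 1) (insert S v) in extends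
  ...   | false = refl
  ...   | true with indepOfSizeᵇ-sound G (t + 1) (insert S v) extends
  ...     | size , indep with () ← trans (sym not-member) (indepOfSizeᵇ-complete G t S
              (suc-injective (trans (sym (size-insert S v v∈S)) (trans size (+-comm t 1))))
              (independent-remove G S v indep))

extensions-≤-non-neighbours : ∀ {n} (G : Graph n) t S u → lookup S u ≡ true →
  extensions G t S ≤ sum (λ v → ⟦ not (lookup S v) ∧ not (adj G u v) ⟧)
extensions-≤-non-neighbours G t S u u∈S = sum-mono bound
  where
  bound : ∀ v → (if lookup S v then 0 else ⟦ indepOfSizeᵇ G (t + 1) (insert S v) ⟧)
              ≤ ⟦ not (lookup S v) ∧ not (adj G u v) ⟧
  bound v with lookup S v in v∈S
  ... | true = z≤n
  ... | false with adj G u v in edge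
  ...   | false = ⟦⟧≤1 _
  ...   | true with indepOfSizeᵇ G (t + 1) (insert S v) in extends
  ...     | false = z≤n
  ...     | true with () ← trans (sym edge)
              (proj₂ (indepOfSizeᵇ-sound G (t + 1) (insert S v) extends) u v
                (insert-⊇ S v u u∈S) (∈-insert S v))

extensions-upper : ∀ {n} (G : Graph n) δ t → (∀ v → δ ≤ degree G v) → 1 ≤ t →
  ∀ S → extensions G t S ≤ ⟦ indepOfSizeᵇ G t S ⟧ * (n ∸ t ∸ δ)
extensions-upper {n} G δ t min-degree 1≤t S with indepOfSizeᵇ G t S in member
... | false = ≤-reflexive (extensions-of-non-member G t S member)
... | true with indepOfSizeᵇ-sound G t S member
...   | size , indep with member-of-nonempty S (subst (1 ≤_) (sym size) 1≤t)
...     | u , u∈S = begin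
  extensions G t S           ≤⟨ extensions-≤-non-neighbours G t S u u∈S ⟩
  sum non-neighbours         ≡⟨ complement-size {a = t} {d = degree G u} partition ⟩
  n ∸ t ∸ degree G u         ≤⟨ ∸-monoʳ-≤ (n ∸ t) (min-degree u) ⟩
  n ∸ t ∸ δ                  ≡⟨ *-identityˡ (n ∸ t ∸ δ) ⟨
  1 * (n ∸ t ∸ δ)            ∎
  where
  open ≤-Reasoning
  non-neighbours : Fin n → ℕ
  non-neighbours v = ⟦ not (lookup S v) ∧ not (adj G u v) ⟧
  partition : sum non-neighbours + (t + degree G u) ≡ n
  partition = subst₂ (λ s d → sum non-neighbours + (s + d) ≡ n)
    (trans (sym (size-as-sum S)) size) (sym (degree-as-sum G u))
    (outside-disjoint-union (lookup S) (adj G u) (λ v → indep u v u∈S))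

inSmallSide : ∀ {n} → ℕ → Fin n → Bool
inSmallSide δ v = toℕ v <ᵇ δ

small-side-size : ∀ n δ → sum (λ (v : Fin n) → ⟦ inSmallSide δ v ⟧) ≤ δ
small-side-size zero δ = z≤n
small-side-size (suc n) zero = ≤-reflexive (sum-replicate-zero n)
small-side-size (suc n) (suc δ) = s≤s (small-side-size n δ)

same-side : ∀ a b → a xor b ≡ false → a ≡ b
same-side false b b≡false = sym b≡false
same-side true false ()
same-side true true _ = refl

-- An independent set of K with more than δ vertices lies in the large side:
-- a member in the small side would pull every member there, giving |S| ≤ δ.
independent-in-large-side : ∀ {δ n} (S : Subset n) → Independent (completeBipartite δ n) S →
  δ < ∣ S ∣ → ∀ w → lookup S w ≡ true → inSmallSide δ w ≡ false
independent-in-large-side {δ} {n} S indep δ<∣S∣ w w∈S with inSmallSide δ w in w-small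
... | false = refl
... | true = ⊥-elim (<⇒≱ δ<∣S∣ (begin
  ∣ S ∣                                ≡⟨ size-as-sum S ⟩
  sum (λ v → ⟦ lookup S v ⟧)           ≤⟨ sum-mono members-small ⟩
  sum (λ (v : Fin n) → ⟦ inSmallSide δ v ⟧) ≤⟨ small-side-size n δ ⟩
  δ                                    ∎))
  where
  open ≤-Reasoning
  members-small : ∀ (v : Fin n) → ⟦ lookup S v ⟧ ≤ ⟦ inSmallSide δ v ⟧
  members-small v with lookup S v in v∈S
  ... | false = z≤n
  ... | true rewrite sym (trans (sym w-small) (same-side (inSmallSide δ w) (inSmallSide δ v) (indep w v w∈S v∈S))) = ≤-refl

-- Every set inside the large side is independent in K, so adding a further
-- large-side vertex to such a set keeps it independent.
large-side-extends : ∀ {δ n} (S : Subset n) →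
  (∀ w → lookup S w ≡ true → inSmallSide δ w ≡ false) →
  ∀ v → inSmallSide δ v ≡ false → Independent (completeBipartite δ n) (insert S v)
large-side-extends {δ} S S-large v v-large x y x∈ y∈ =
  subst₂ (λ a b → a xor b ≡ false) (sym (large x x∈)) (sym (large y y∈)) refl
  where
  large : ∀ w → lookup (insert S v) w ≡ true → inSmallSide δ w ≡ false
  large w w∈ with insert-⊆ S v w w∈
  ... | inj₁ refl = v-large
  ... | inj₂ w∈S = S-large w w∈S

extensions-lower : ∀ δ t n → δ < t →
  ∀ S → ⟦ indepOfSizeᵇ (completeBipartite δ n) t S ⟧ * (n ∸ t ∸ δ) ≤ extensions (completeBipartite δ n) t S
extensions-lower δ t n δ<t S with indepOfSizeᵇ (completeBipartite δ n) t S in member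
... | false = z≤n
... | true with indepOfSizeᵇ-sound (completeBipartite δ n) t S member
...   | size , indep = begin
  1 * (n ∸ t ∸ δ)              ≡⟨ *-identityˡ (n ∸ t ∸ δ) ⟩
  n ∸ t ∸ δ                    ≤⟨ ∸-monoʳ-≤ (n ∸ t) (small-side-size n δ) ⟩
  n ∸ t ∸ small                ≡⟨ complement-size {a = t} {d = small} partition ⟨
  sum large-outside-S          ≤⟨ sum-mono bound ⟩
  extensions K t S             ∎
  where
  open ≤-Reasoning
  K : Graph n
  K = completeBipartite δ n
  small : ℕ
  small = sum (λ (v : Fin n) → ⟦ inSmallSide δ v ⟧)
  large-outside-S : Fin n → ℕ
  large-outside-S v = ⟦ not (lookup S v) ∧ not (inSmallSide δ v) ⟧
  S-large : ∀ w → lookup S w ≡ true → inSmallSide δ w ≡ false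
  S-large = independent-in-large-side {δ} S indep (subst (δ <_) (sym size) δ<t)
  partition : sum large-outside-S + (t + small) ≡ n
  partition = subst (λ s → sum large-outside-S + (s + small) ≡ n)
    (trans (sym (size-as-sum S)) size)
    (outside-disjoint-union (lookup S) (inSmallSide δ) S-large)
  bound : ∀ v → large-outside-S v ≤ (if lookup S v then 0 else ⟦ indepOfSizeᵇ K (t + 1) (insert S v) ⟧)
  bound v with lookup S v in v∈S | inSmallSide δ v in v-small
  ... | true | _ = z≤n
  ... | false | true = z≤n
  ... | false | false rewrite indepOfSizeᵇ-complete K (t + 1) (insert S v)
          (trans (size-insert S v v∈S) (trans (cong suc size) (+-comm 1 t)))
          (large-side-extends {δ} S S-large v v-small) = ≤-refl

corollary2p2 : (δ t n : ℕ) → 2 ≤ δ → δ + 1 ≤ t →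
    ((G : Graph n) → MinDegreeExactly G δ → iₜ t G ≤ iₜ t (completeBipartite δ n)) →
    (G : Graph n) → MinDegreeExactly G δ → iₜ (t + 1) G ≤ iₜ (t + 1) (completeBipartite δ n)
corollary2p2 δ t n _ δ+1≤t hypothesis G min-degree@(degree≥δ , _) =
  *-cancelʳ-≤ (iₜ (t + 1) G) (iₜ (t + 1) K) (t + 1) {{>-nonZero (m≤n+m 1 t)}} (begin
    iₜ (t + 1) G * (t + 1)              ≡⟨ extensions-double-count G t ⟨
    ∑ₛ (extensions G t)                 ≤⟨ ∑ₛ-mono (extensions-upper G δ t degree≥δ 1≤t) ⟩
    ∑ₛ (λ S → ⟦ indepG S ⟧ * c)         ≡⟨ ∑ₛ-distribʳ-* (⟦_⟧ ∘ indepG) c ⟩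
    ∑ₛ (λ S → ⟦ indepG S ⟧) * c         ≡⟨ cong (_* c) (iₜ-as-sum G t) ⟨
    iₜ t G * c                          ≤⟨ *-monoˡ-≤ c (hypothesis G min-degree) ⟩
    iₜ t K * c                          ≡⟨ cong (_* c) (iₜ-as-sum K t) ⟩
    ∑ₛ (λ S → ⟦ indepK S ⟧) * c         ≡⟨ ∑ₛ-distribʳ-* (⟦_⟧ ∘ indepK) c ⟨
    ∑ₛ (λ S → ⟦ indepK S ⟧ * c)         ≤⟨ ∑ₛ-mono (extensions-lower δ t n δ<t) ⟩
    ∑ₛ (extensions K t)                 ≡⟨ extensions-double-count K t ⟩
    iₜ (t + 1) K * (t + 1)              ∎)
  where
  open ≤-Reasoning
  K : Graph n
  K = completeBipartite δ n
  c : ℕ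
  c = n ∸ t ∸ δ
  indepG indepK : Subset n → Bool
  indepG = indepOfSizeᵇ G t
  indepK = indepOfSizeᵇ K t
  δ<t : δ < t
  δ<t = subst (_≤ t) (+-comm δ 1) δ+1≤t
  1≤t : 1 ≤ t
  1≤t = ≤-trans (s≤s z≤n) δ<t
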